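{- Let $n\ge 2k>1$ and let $\mathcal F\subset\binom{[n]}{k}$ with $|\mathcal F|>\binom{n-1}{k-1}$. If $d(\mathcal F)<\frac12|\mathcal F|$, then $$c(1)>\frac{|\mathcal F|}{2k\binom{n-1}{k-1}}>\frac1{2k}.$$
   Context: For $\mathcal F\subset\binom{[n]}{k}$, $d(\mathcal F)=\max_{F\in\mathcal F}|\{G\in\mathcal F:G\cap F=\emptyset\}|$. For $x\in[n]$, $\mathcal F(x)=\{F\setminus\{x\}:x\in F\in\mathcal F\}$, and $c(1)=\binom{n-1}{k-1}^{ -1}\max_{x\in[n]}|\mathcal F(x)|$. -}

module Defs where

open import Data.Nat using (ℕ; _⊔_; _≟_)
open import Data.Bool using (Bool; true; false; if_then_else_)
open import Data.List using (List; []; _∷_; map; foldr; length; filter)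
open import Data.Fin using (Fin)
open import Data.Fin.Subset using (Subset; _∩_; ∣_∣; _∈_)
open import Data.Fin.Subset.Properties using (_∈?_)
open import Data.Vec using (lookup)
open import Relation.Nullary.Decidable using (⌊_⌋)

-- A family of subsets of [n] is a list of subsets (distinctness imposed in the statement).

maxℕ : List ℕ → ℕ
maxℕ = foldr _⊔_ 0

disjointCount : {n : ℕ} → List (Subset n) → Subset n → ℕ
disjointCount 𝓕 F = length (filter (λ G → ∣ G ∩ F ∣ ≟ 0) 𝓕)

d : {n : ℕ} → List (Subset n) → ℕ
d 𝓕 = maxℕ (map (disjointCount 𝓕) 𝓕)

-- |𝓕(x)| = number of members containing x (F ↦ F \ {x} is injective on these)
degree : {n : ℕ} → List (Subset n) → Fin n → ℕ
degree 𝓕 x = length (filter (λ F → x ∈? F) 𝓕)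

maxDegree : {n : ℕ} → List (Subset n) → ℕ
maxDegree {n} 𝓕 = maxℕ (map (degree 𝓕) (Data.List.allFin n))

-- Fix F ∈ 𝓕. Each G ∈ 𝓕 is either disjoint from F, which happens for at most d(𝓕) members,
-- or meets F, and by double counting Σ_G |G ∩ F| = Σ_{x ∈ F} |𝓕(x)| ≤ k · max_x |𝓕(x)|.
-- So |𝓕| ≤ d(𝓕) + k · max_x |𝓕(x)|, which together with 2 d(𝓕) < |𝓕| gives |𝓕| < 2k · max_x |𝓕(x)|.
module Submission where

open import Defs
open import Data.Nat using (ℕ; _*_; _<_; _≤_; _∸_)
open import Data.Nat.Combinatorics using (_C_)
open import Data.List using (List; length)
open import Data.List.Relation.Unary.All using (All)
open import Data.List.Relation.Unary.Unique.Propositional using (Unique)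
open import Data.Fin.Subset using (Subset; ∣_∣)
open import Data.Product using (_×_)
open import Relation.Binary.PropositionalEquality using (_≡_)

open import Data.Bool using (true; false)
open import Data.Fin using (zero; suc)
open import Data.Fin.Subset using (_∩_; inside; outside)
open import Data.Fin.Subset.Properties using (_∈?_)
open import Data.List using ([]; _∷_; map; filter)
open import Data.List.Properties using (filter-accept; filter-reject)
open import Data.List.Membership.Propositional using (_∈_)
open import Data.List.Membership.Propositional.Properties using (∈-map⁺; ∈-allFin)
open import Data.List.Relation.Unary.All using (_∷_)
open import Data.List.Relation.Unary.Any using (here; there)
open import Data.Nat using (zero; suc; _+_; _≟_; z≤n; s≤s; >-nonZero)
open import Data.Nat.Combinatorics using (nCk+nC[k+1]≡[n+1]C[k+1])
open import Data.Nat.ListAction using (sum)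
open import Data.Nat.Properties
open import Algebra.Properties.CommutativeSemigroup +-commutativeSemigroup using (x∙yz≈y∙xz)
open import Data.Nat.Solver using (module +-*-Solver)
open import Data.Product using (_,_)
open import Data.Vec using ([]; _∷_; tail)
open import Relation.Nullary using (yes; no)
open import Relation.Binary.PropositionalEquality using (refl; sym; trans; cong; subst)

open +-*-Solver

private
  variable
    n : ℕ

∈⇒≤maxℕ : ∀ {x xs} → x ∈ xs → x ≤ maxℕ xs
∈⇒≤maxℕ {xs = y ∷ ys} (here refl) = m≤m⊔n y (maxℕ ys)
∈⇒≤maxℕ {xs = y ∷ ys} (there x∈ys) = m≤n⇒m≤o⊔n y (∈⇒≤maxℕ x∈ys)

0<nCk : ∀ {n k} → k ≤ n → 0 < n C k
0<nCk {k = zero} _ = s≤s z≤n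
0<nCk {suc n} {suc k} (s≤s k≤n) =
  subst (0 <_) (nCk+nC[k+1]≡[n+1]C[k+1] n k) (≤-trans (0<nCk k≤n) (m≤m+n (n C k) (n C suc k)))

length≤zeros+sum : ∀ {a} {A : Set a} (f : A → ℕ) (xs : List A) →
  length xs ≤ length (filter (λ x → f x ≟ 0) xs) + sum (map f xs)
length≤zeros+sum f [] = z≤n
length≤zeros+sum f (x ∷ xs) with f x ≟ 0
... | yes fx≡0 rewrite filter-accept (λ y → f y ≟ 0) {xs = xs} fx≡0 =
  s≤s (≤-trans (length≤zeros+sum f xs) (+-monoʳ-≤ _ (m≤n+m (sum (map f xs)) (f x))))
... | no fx≢0 rewrite filter-reject (λ y → f y ≟ 0) {xs = xs} fx≢0 = begin
  suc (length xs)                ≤⟨ s≤s (length≤zeros+sum f xs) ⟩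
  suc (zs + s)                   ≡⟨ +-suc zs s ⟨
  zs + suc s                     ≤⟨ +-monoʳ-≤ zs (+-monoˡ-≤ s (n≢0⇒n>0 fx≢0)) ⟩
  zs + (f x + s)                 ∎
  where
  open ≤-Reasoning
  zs s : ℕ
  zs = length (filter (λ x → f x ≟ 0) xs)
  s = sum (map f xs)

intersectionSum : List (Subset n) → Subset n → ℕ
intersectionSum 𝓕 F = sum (map (λ G → ∣ G ∩ F ∣) 𝓕)

intersectionSum-outside : ∀ (𝓕 : List (Subset (suc n))) t →
  intersectionSum 𝓕 (outside ∷ t) ≡ intersectionSum (map tail 𝓕) t
intersectionSum-outside [] t = refl
intersectionSum-outside ((true ∷ g) ∷ 𝓕) t = cong (∣ g ∩ t ∣ +_) (intersectionSum-outside 𝓕 t)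
intersectionSum-outside ((false ∷ g) ∷ 𝓕) t = cong (∣ g ∩ t ∣ +_) (intersectionSum-outside 𝓕 t)

intersectionSum-inside : ∀ (𝓕 : List (Subset (suc n))) t →
  intersectionSum 𝓕 (inside ∷ t) ≡ degree 𝓕 zero + intersectionSum (map tail 𝓕) t
intersectionSum-inside [] t = refl
intersectionSum-inside ((true ∷ g) ∷ 𝓕) t =
  cong suc (trans (cong (∣ g ∩ t ∣ +_) (intersectionSum-inside 𝓕 t))
                  (x∙yz≈y∙xz ∣ g ∩ t ∣ (degree 𝓕 zero) (intersectionSum (map tail 𝓕) t)))
intersectionSum-inside ((false ∷ g) ∷ 𝓕) t =
  trans (cong (∣ g ∩ t ∣ +_) (intersectionSum-inside 𝓕 t))
        (x∙yz≈y∙xz ∣ g ∩ t ∣ (degree 𝓕 zero) (intersectionSum (map tail 𝓕) t))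

degree-map-tail : ∀ (𝓕 : List (Subset (suc n))) x → degree (map tail 𝓕) x ≡ degree 𝓕 (suc x)
degree-map-tail [] x = refl
degree-map-tail ((_ ∷ g) ∷ 𝓕) x with x ∈? g
... | yes _ = cong suc (degree-map-tail 𝓕 x)
... | no _ = degree-map-tail 𝓕 x

tail-degree≤M : ∀ (𝓕 : List (Subset (suc n))) {M} →
  (∀ x → degree 𝓕 x ≤ M) → ∀ x → degree (map tail 𝓕) x ≤ M
tail-degree≤M 𝓕 degree≤M x = subst (_≤ _) (sym (degree-map-tail 𝓕 x)) (degree≤M (suc x))

intersectionSum≤∣F∣*M : ∀ (F : Subset n) (𝓕 : List (Subset n)) {M} →
  (∀ x → degree 𝓕 x ≤ M) → intersectionSum 𝓕 F ≤ ∣ F ∣ * M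
intersectionSum≤∣F∣*M [] [] _ = z≤n
intersectionSum≤∣F∣*M [] ([] ∷ 𝓕) {M} _ = intersectionSum≤∣F∣*M [] 𝓕 {M} (λ ())
intersectionSum≤∣F∣*M (true ∷ t) 𝓕 {M} degree≤M =
  subst (_≤ M + ∣ t ∣ * M) (sym (intersectionSum-inside 𝓕 t))
    (+-mono-≤ (degree≤M zero) (intersectionSum≤∣F∣*M t (map tail 𝓕) (tail-degree≤M 𝓕 degree≤M)))
intersectionSum≤∣F∣*M (false ∷ t) 𝓕 degree≤M =
  subst (_≤ _) (sym (intersectionSum-outside 𝓕 t))
    (intersectionSum≤∣F∣*M t (map tail 𝓕) (tail-degree≤M 𝓕 degree≤M))

degree≤maxDegree : ∀ (𝓕 : List (Subset n)) x → degree 𝓕 x ≤ maxDegree 𝓕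
degree≤maxDegree 𝓕 x = ∈⇒≤maxℕ (∈-map⁺ (degree 𝓕) (∈-allFin x))

disjointCount≤d : ∀ {𝓕 : List (Subset n)} {F} → F ∈ 𝓕 → disjointCount 𝓕 F ≤ d 𝓕
disjointCount≤d {𝓕 = 𝓕} F∈𝓕 = ∈⇒≤maxℕ (∈-map⁺ (disjointCount 𝓕) F∈𝓕)

length≤d+∣F∣*maxDegree : ∀ {𝓕 : List (Subset n)} {F} → F ∈ 𝓕 →
  length 𝓕 ≤ d 𝓕 + ∣ F ∣ * maxDegree 𝓕
length≤d+∣F∣*maxDegree {𝓕 = 𝓕} {F} F∈𝓕 = begin
  length 𝓕                                     ≤⟨ length≤zeros+sum (λ G → ∣ G ∩ F ∣) 𝓕 ⟩
  disjointCount 𝓕 F + intersectionSum 𝓕 F      ≤⟨ +-mono-≤ (disjointCount≤d F∈𝓕)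
                                                     (intersectionSum≤∣F∣*M F 𝓕 (degree≤maxDegree 𝓕)) ⟩
  d 𝓕 + ∣ F ∣ * maxDegree 𝓕                    ∎
  where open ≤-Reasoning

≤m+n∧2m<⇒<2n : ∀ {l} m n → l ≤ m + n → 2 * m < l → l < 2 * n
≤m+n∧2m<⇒<2n {l} m n l≤m+n 2m<l = +-cancelʳ-< (2 * m) l (2 * n) (begin-strict
  l + 2 * m               <⟨ +-monoʳ-< l 2m<l ⟩
  l + l                   ≤⟨ +-mono-≤ l≤m+n l≤m+n ⟩
  (m + n) + (m + n)       ≡⟨ solve 2 (λ m n → (m :+ n) :+ (m :+ n) := con 2 :* n :+ con 2 :* m) refl m n ⟩
  2 * n + 2 * m           ∎)
  where open ≤-Reasoning

length<2k*maxDegree : ∀ {k} (𝓕 : List (Subset n)) → All (λ F → ∣ F ∣ ≡ k) 𝓕 →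
  2 * d 𝓕 < length 𝓕 → length 𝓕 < 2 * k * maxDegree 𝓕
length<2k*maxDegree {k = k} 𝓕@(F ∷ _) (∣F∣≡k ∷ _) 2d<length =
  subst (length 𝓕 <_) (sym (*-assoc 2 k (maxDegree 𝓕)))
    (≤m+n∧2m<⇒<2n (d 𝓕) (k * maxDegree 𝓕) length≤d+k*M 2d<length)
  where
  length≤d+k*M : length 𝓕 ≤ d 𝓕 + k * maxDegree 𝓕
  length≤d+k*M = subst (λ s → length 𝓕 ≤ d 𝓕 + s * maxDegree 𝓕) ∣F∣≡k
    (length≤d+∣F∣*maxDegree {𝓕 = 𝓕} (here refl))

lemma3 : (n k : ℕ) → 1 < 2 * k → 2 * k ≤ n →
    (𝓕 : List (Subset n)) → Unique 𝓕 → All (λ F → ∣ F ∣ ≡ k) 𝓕 →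
    ((n ∸ 1) C (k ∸ 1)) < length 𝓕 →
    2 * d 𝓕 < length 𝓕 →
    (length 𝓕 * ((n ∸ 1) C (k ∸ 1)) < maxDegree 𝓕 * (2 * k * ((n ∸ 1) C (k ∸ 1))))
    × (1 * (2 * k * ((n ∸ 1) C (k ∸ 1))) < length 𝓕 * (2 * k))
lemma3 n k 1<2k 2k≤n 𝓕 _ uniform c<length 2d<length = length*c<maxDegree*2kc , 2kc<length*2k
  where
  c : ℕ
  c = (n ∸ 1) C (k ∸ 1)
  0<c : 0 < c
  0<c = 0<nCk (∸-monoˡ-≤ 1 (≤-trans (m≤n*m k 2) 2k≤n))
  length*c<maxDegree*2kc : length 𝓕 * c < maxDegree 𝓕 * (2 * k * c)
  length*c<maxDegree*2kc = subst (length 𝓕 * c <_)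
    (solve 3 (λ k M c → con 2 :* k :* M :* c := M :* (con 2 :* k :* c)) refl k (maxDegree 𝓕) c)
    (*-monoˡ-< c {{>-nonZero 0<c}} (length<2k*maxDegree 𝓕 uniform 2d<length))
  2kc<length*2k : 1 * (2 * k * c) < length 𝓕 * (2 * k)
  2kc<length*2k = subst (_< length 𝓕 * (2 * k))
    (trans (*-comm c (2 * k)) (sym (*-identityˡ (2 * k * c))))
    (*-monoˡ-< (2 * k) {{>-nonZero (m<n⇒0<n 1<2k)}} c<length)
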